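{- Let $k \geq 1$ be an integer and let $T$ be a bidirected tree (i.e. $T=\overleftrightarrow{G}$ for a tree $G$) with $n(T)$ vertices. If $T^*$ is obtained from $T$ by subdividing every arc at most $k-1$ times, then $\mathrm{mader}_{\vec{\chi}}^{(2k)}(T^*) \leq \mathrm{mader}_{\vec{\chi}}(T) = n(T)$.
   Context: Digraphs are finite, without loops or parallel arcs (digons allowed). For an undirected graph $G$, $\overleftrightarrow{G}$ is the digraph on $V(G)$ with both arcs $uv$ and $vu$ for every edge $uv$ of $G$. The dichromatic number $\vec{\chi}(D)$ is the least $k$ such that $V(D)$ can be partitioned into $k$ sets each inducing an acyclic subdigraph. The digirth of $D$ is the length of a shortest directed cycle ($+\infty$ if $D$ is acyclic). A subdivision of $F$ is obtained by replacing each arc $uv$ by a directed path from $u$ to $v$; subdividing an arc $t$ times means the path has $t$ internal vertices. $D$ contains $F$ as a subdivision if some subdigraph of $D$ is a subdivision of $F$. $\mathrm{mader}_{\vec{\chi}}^{(g)}(F)$ is the least integer $c$ such that every digraph with $\vec{\chi}\geq c$ and digirth at least $g$ contains a subdivision of $F$, and $\mathrm{mader}_{\vec{\chi}}(F)=\mathrm{mader}_{\vec{\chi}}^{(2)}(F)$ is the least $c$ such that every digraph with $\vec{\chi}\geq c$ contains a subdivision of $F$. -}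

module Defs where

open import Data.Nat using (ℕ; zero; suc; _≤_; _<_)
open import Data.Fin using (Fin; zero; suc; inject₁; fromℕ)
open import Data.Bool using (Bool; true; false)
open import Data.Product using (Σ; ∃; _×_; _,_)
open import Data.Sum using (_⊎_)
open import Relation.Nullary using (¬_)
open import Relation.Binary.PropositionalEquality using (_≡_; _≢_)
open import Function.Definitions using (Injective)

-- Digraphs: vertex set Fin size, arc relation given by a Boolean
-- adjacency matrix (so no parallel arcs), no loops; digons allowed.

record Digraph : Set where
  field
    size     : ℕ
    arc      : Fin size → Fin size → Bool
    loopless : ∀ v → arc v v ≡ false
open Digraph public

Vert : Digraph → Set
Vert D = Fin (size D)

Arc : (D : Digraph) → Vert D → Vert D → Set
Arc D u v = arc D u v ≡ true

record DiCycle (D : Digraph) : Set where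
  field
    len   : ℕ
    vert  : Fin (suc len) → Vert D
    inj   : Injective _≡_ _≡_ vert
    step  : ∀ (i : Fin len) → Arc D (vert (inject₁ i)) (vert (suc i))
    close : Arc D (vert (fromℕ len)) (vert zero)
open DiCycle public

cycleLength : ∀ {D} → DiCycle D → ℕ
cycleLength C = suc (len C)

-- digirth(D) ≥ g  (vacuous when D is acyclic: digirth = +∞)
DigirthAtLeast : Digraph → ℕ → Set
DigirthAtLeast D g = ∀ (C : DiCycle D) → g ≤ cycleLength C

AcyclicColouring : Digraph → ℕ → Set
AcyclicColouring D j =
  Σ (Vert D → Fin j) λ f →
    ∀ (C : DiCycle D) (c : Fin j) → ¬ (∀ i → f (vert C i) ≡ c)

DichromaticAtLeast : Digraph → ℕ → Set
DichromaticAtLeast D c = ∀ j → j < c → ¬ AcyclicColouring D j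

record DiPath (D : Digraph) (a b : Vert D) : Set where
  field
    inner : ℕ
    seq   : Fin (suc (suc inner)) → Vert D
    start : seq zero ≡ a
    end   : seq (fromℕ (suc inner)) ≡ b
    pinj  : Injective _≡_ _≡_ seq
    pstep : ∀ (i : Fin (suc inner)) → Arc D (seq (inject₁ i)) (seq (suc i))

  internal : Fin inner → Vert D
  internal i = seq (suc (inject₁ i))
open DiPath public

record IsSubdivision (F H : Digraph) : Set where
  field
    branch     : Vert F → Vert H
    branch-inj : Injective _≡_ _≡_ branch
    path       : ∀ u v → Arc F u v → DiPath H (branch u) (branch v)
    internal-not-branch :
      ∀ u v (e : Arc F u v) i w → internal (path u v e) i ≢ branch w
    internal-disjoint :
      ∀ u v (e : Arc F u v) u' v' (e' : Arc F u' v') i i' →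
      internal (path u v e) i ≡ internal (path u' v' e') i' → u ≡ u' × v ≡ v'
    covers-vertices :
      ∀ x → (∃ λ w → branch w ≡ x)
            ⊎ (∃ λ u → ∃ λ v → Σ (Arc F u v) λ e →
                 ∃ λ i → internal (path u v e) i ≡ x)
    covers-arcs :
      ∀ x y → Arc H x y →
      ∃ λ u → ∃ λ v → Σ (Arc F u v) λ e →
        ∃ λ i → seq (path u v e) (inject₁ i) ≡ x × seq (path u v e) (suc i) ≡ y
open IsSubdivision public

Embeds : Digraph → Digraph → Set
Embeds H D =
  Σ (Vert H → Vert D) λ ι →
    Injective _≡_ _≡_ ι × (∀ x y → Arc H x y → Arc D (ι x) (ι y))

ContainsSubdivision : Digraph → Digraph → Set
ContainsSubdivision D F = Σ Digraph λ H → IsSubdivision F H × Embeds H D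

-- mader^(g)_χ(F) : least c such that every digraph with dichromatic
-- number ≥ c and digirth ≥ g contains a subdivision of F.

MaderProp : ℕ → Digraph → ℕ → Set
MaderProp g F c =
  ∀ (D : Digraph) → DichromaticAtLeast D c → DigirthAtLeast D g →
  ContainsSubdivision D F

IsMader : ℕ → Digraph → ℕ → Set
IsMader g F c = MaderProp g F c × (∀ c' → c' < c → ¬ MaderProp g F c')

record Graph : Set where
  field
    gsize   : ℕ
    adj     : Fin gsize → Fin gsize → Bool
    adj-sym : ∀ u v → adj u v ≡ adj v u
    irrefl  : ∀ v → adj v v ≡ false
open Graph public

GVert : Graph → Set
GVert G = Fin (gsize G)

Adj : (G : Graph) → GVert G → GVert G → Set
Adj G u v = adj G u v ≡ true

record Walk (G : Graph) (a b : GVert G) : Set where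
  field
    wlen  : ℕ
    wvert : Fin (suc wlen) → GVert G
    wstart : wvert zero ≡ a
    wend  : wvert (fromℕ wlen) ≡ b
    wstep : ∀ (i : Fin wlen) → Adj G (wvert (inject₁ i)) (wvert (suc i))

record GCycle (G : Graph) : Set where
  field
    clen   : ℕ
    clen≥2 : 2 ≤ clen
    cvert  : Fin (suc clen) → GVert G
    cinj   : Injective _≡_ _≡_ cvert
    cstep  : ∀ (i : Fin clen) → Adj G (cvert (inject₁ i)) (cvert (suc i))
    cclose : Adj G (cvert (fromℕ clen)) (cvert zero)

IsTree : Graph → Set
IsTree G = 1 ≤ gsize G × (∀ u v → Walk G u v) × ¬ GCycle G

bidirect : Graph → Digraph
bidirect G = record { size = gsize G ; arc = adj G ; loopless = irrefl G }

{-# OPTIONS --safe #-}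
-- Colour the vertices of D greedily in index order, giving x the least colour c such
-- that no directed cycle through x has all its other vertices earlier and of colour c.
-- No colour class contains a directed cycle (consider its latest vertex), so if
-- χ⃗(D) ≥ n some vertex r gets colour at least n − 1; and by minimality a vertex of
-- colour c' lies, for every c < c', on a directed cycle whose other vertices all have
-- colour c. Order the tree so that every vertex comes after its parent, send the root
-- to r and the j-th vertex to the vertex at distance k along such a cycle of colour
-- n − 1 − j through the image of its parent. The two segments of that cycle are the
-- subdivided digon between the two images, each with at least k − 1 internal vertices
-- because the digirth is at least 2k, and the distinct colours keep all of them apart.
-- Stretching the last arc of each subdivided arc of T* along these paths embeds T*.
-- Conversely the complete digraph on n − 1 vertices has dichromatic number n − 1 but
-- too few vertices to contain a subdivision of T.
module Submission where

open import Defs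
open import Data.Nat using (ℕ; zero; suc; _+_; _*_; _∸_; _≤_; _<_; z≤n; s≤s; s≤s⁻¹; _≤?_; _<?_)
open import Data.Nat.Properties
open import Data.Nat.Induction using (<-rec)
open import Data.Bool using (true; not) renaming (_≟_ to _≟ᵇ_)
open import Data.Fin using (Fin; zero; suc; toℕ; fromℕ; fromℕ<; inject₁)
open import Data.Fin.Properties
  using ( toℕ-injective; toℕ<n; toℕ-fromℕ; toℕ-fromℕ<; fromℕ<-toℕ; toℕ-inject₁
        ; any?; all?; injective⇒≤; pigeonhole )
  renaming (_≟_ to _≟ᶠ_; suc-injective to suc-injectiveᶠ; <⇒≢ to <⇒≢ᶠ)
open import Data.Fin.Relation.Unary.Top using (view; ‵fromℕ; ‵inject₁)
open import Data.Vec.Functional using (_∷_; tail)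
open import Data.Product using (Σ; ∃; _×_; _,_; proj₁; proj₂)
open import Data.Sum using (_⊎_; inj₁; inj₂)
open import Data.Unit using (⊤; tt)
import Data.Empty.Irrelevant as Irrelevant
open import Function using (_∘_)
open import Function.Definitions using (Injective)
open import Axiom.UniquenessOfIdentityProofs using (module Decidable⇒UIP)
open import Relation.Nullary using (Dec; yes; no; ¬_; ¬?; does; contradiction)
open import Relation.Nullary.Decidable using (map′; decidable-stable; dec-true; dec-false; _×-dec_; _⊎-dec_; _→-dec_)
open import Relation.Unary using (Decidable)
open import Relation.Binary.Definitions using (tri<; tri≈; tri>)
open import Relation.Binary.PropositionalEquality

open Decidable⇒UIP _≟ᵇ_ using () renaming (≡-irrelevant to Bool-≡-irrelevant)

-- Positions out of range are sent to 0, so position suc (len C) of a cycle C is its start again.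
clamp : (m t : ℕ) → Fin (suc m)
clamp m t with t ≤? m
... | yes t≤m = fromℕ< (s≤s t≤m)
... | no  _   = zero

toℕ-clamp : ∀ {m t} → t ≤ m → toℕ (clamp m t) ≡ t
toℕ-clamp {m} {t} t≤m with t ≤? m
... | yes _   = toℕ-fromℕ< _
... | no  t≰m = contradiction t≤m t≰m

clamp-toℕ : ∀ {m} (i : Fin (suc m)) → clamp m (toℕ i) ≡ i
clamp-toℕ i = toℕ-injective (toℕ-clamp (s≤s⁻¹ (toℕ<n i)))

clamp-overflow : ∀ {m t} → m < t → clamp m t ≡ zero
clamp-overflow {m} {t} m<t with t ≤? m
... | yes t≤m = contradiction t≤m (<⇒≱ m<t)
... | no  _   = refl

module _ {D : Digraph} {a b : Vert D} (P : DiPath D a b) where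

  pathAt : ℕ → Vert D
  pathAt t = seq P (clamp (suc (inner P)) t)

  seq≡pathAt : ∀ i → seq P i ≡ pathAt (toℕ i)
  seq≡pathAt i = cong (seq P) (sym (clamp-toℕ i))

  pathAt-start : pathAt 0 ≡ a
  pathAt-start = trans (sym (seq≡pathAt zero)) (start P)

  pathAt-end : pathAt (suc (inner P)) ≡ b
  pathAt-end = begin
    pathAt (suc (inner P))         ≡⟨ cong pathAt (sym (toℕ-fromℕ (suc (inner P)))) ⟩
    pathAt (toℕ (fromℕ (suc (inner P)))) ≡⟨ sym (seq≡pathAt _) ⟩
    seq P (fromℕ (suc (inner P)))  ≡⟨ end P ⟩
    b                              ∎
    where open ≡-Reasoning

  pathAt-injective : ∀ {s t} → s ≤ suc (inner P) → t ≤ suc (inner P) → pathAt s ≡ pathAt t → s ≡ t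
  pathAt-injective {s} {t} s≤ t≤ eq =
    trans (sym (toℕ-clamp {t = s} s≤)) (trans (cong toℕ (pinj P eq)) (toℕ-clamp {t = t} t≤))

  pathAt-arc : ∀ {t} → t ≤ inner P → Arc D (pathAt t) (pathAt (suc t))
  pathAt-arc {t} t≤ = subst₂ (Arc D) from to (pstep P i)
    where
    i : Fin (suc (inner P))
    i = fromℕ< (s≤s t≤)
    from : seq P (inject₁ i) ≡ pathAt t
    from = trans (seq≡pathAt (inject₁ i)) (cong pathAt (trans (toℕ-inject₁ i) (toℕ-fromℕ< (s≤s t≤))))
    to : seq P (suc i) ≡ pathAt (suc t)
    to = trans (seq≡pathAt (suc i)) (cong (λ s → pathAt (suc s)) (toℕ-fromℕ< (s≤s t≤)))

  internal≡pathAt : ∀ i → internal P i ≡ pathAt (suc (toℕ i))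
  internal≡pathAt i = trans (seq≡pathAt (suc (inject₁ i))) (cong (λ t → pathAt (suc t)) (toℕ-inject₁ i))

castPath : ∀ {D a b a' b'} → a ≡ a' → b ≡ b' → DiPath D a b → DiPath D a' b'
castPath a≡a' b≡b' P = record
  { inner = inner P ; seq = seq P ; pinj = pinj P ; pstep = pstep P
  ; start = trans (start P) a≡a' ; end = trans (end P) b≡b' }

mkDiPath : ∀ {D} (f : ℕ → Vert D) (m : ℕ) →
  (∀ {s t} → s ≤ suc m → t ≤ suc m → f s ≡ f t → s ≡ t) →
  (∀ {t} → t ≤ m → Arc D (f t) (f (suc t))) →
  DiPath D (f 0) (f (suc m))
mkDiPath {D} f m f-inj f-arc = record
  { inner = m
  ; seq   = λ i → f (toℕ i)
  ; start = refl
  ; end   = cong f (toℕ-fromℕ (suc m))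
  ; pinj  = λ {i} {j} eq → toℕ-injective (f-inj (bound i) (bound j) eq)
  ; pstep = λ i → subst (λ t → Arc D (f t) (f (suc (toℕ i)))) (sym (toℕ-inject₁ i)) (f-arc (bound i))
  }
  where
  bound : ∀ {n} (i : Fin (suc n)) → toℕ i ≤ n
  bound i = s≤s⁻¹ (toℕ<n i)

module _ {D : Digraph} (C : DiCycle D) where

  cycleAt : ℕ → Vert D
  cycleAt t = vert C (clamp (len C) t)

  vert≡cycleAt : ∀ i → vert C i ≡ cycleAt (toℕ i)
  vert≡cycleAt i = cong (vert C) (sym (clamp-toℕ i))

  cycleAt-wrap : cycleAt (suc (len C)) ≡ cycleAt 0
  cycleAt-wrap = cong (vert C) (clamp-overflow ≤-refl)

  cycleAt-injective : ∀ {s t} → s ≤ len C → t ≤ len C → cycleAt s ≡ cycleAt t → s ≡ t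
  cycleAt-injective {s} {t} s≤ t≤ eq =
    trans (sym (toℕ-clamp {t = s} s≤)) (trans (cong toℕ (inj C eq)) (toℕ-clamp {t = t} t≤))

  cycleAt-injective⁺ : ∀ {s t} → s ≤ len C → t ≤ len C → cycleAt (suc s) ≡ cycleAt (suc t) → s ≡ t
  cycleAt-injective⁺ {s} {t} s≤ t≤ eq with m≤n⇒m<n∨m≡n s≤ | m≤n⇒m<n∨m≡n t≤
  ... | inj₁ s< | inj₁ t< = suc-injective (cycleAt-injective s< t< eq)
  ... | inj₂ refl | inj₂ refl = refl
  ... | inj₁ s< | inj₂ refl = contradiction (cycleAt-injective s< z≤n (trans eq cycleAt-wrap)) λ ()
  ... | inj₂ refl | inj₁ t< = contradiction (cycleAt-injective t< z≤n (trans (sym eq) cycleAt-wrap)) λ ()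

  cycleAt-arc : ∀ {t} → t ≤ len C → Arc D (cycleAt t) (cycleAt (suc t))
  cycleAt-arc {t} t≤ with m≤n⇒m<n∨m≡n t≤
  ... | inj₁ t< = subst₂ (Arc D) from to (step C i)
    where
    i : Fin (len C)
    i = fromℕ< t<
    from : vert C (inject₁ i) ≡ cycleAt t
    from = trans (vert≡cycleAt (inject₁ i)) (cong cycleAt (trans (toℕ-inject₁ i) (toℕ-fromℕ< t<)))
    to : vert C (suc i) ≡ cycleAt (suc t)
    to = trans (vert≡cycleAt (suc i)) (cong (λ s → cycleAt (suc s)) (toℕ-fromℕ< t<))
  ... | inj₂ refl = subst₂ (Arc D) from (sym cycleAt-wrap) (close C)
    where
    from : vert C (fromℕ (len C)) ≡ cycleAt (len C)
    from = trans (vert≡cycleAt (fromℕ (len C))) (cong cycleAt (toℕ-fromℕ (len C)))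

  cycleSegment-injective : ∀ {r m s t} → m < len C → r + suc m ≤ suc (len C) →
    s ≤ suc m → t ≤ suc m → cycleAt (r + s) ≡ cycleAt (r + t) → s ≡ t
  cycleSegment-injective {zero} m< _ s≤ t≤ = cycleAt-injective (≤-trans s≤ m<) (≤-trans t≤ m<)
  cycleSegment-injective {suc r} {m} {s} {t} _ r+m< s≤ t≤ eq =
    +-cancelˡ-≡ r s t (cycleAt-injective⁺ (bound s≤) (bound t≤) eq)
    where
    bound : ∀ {u} → u ≤ suc m → r + u ≤ len C
    bound u≤ = ≤-trans (+-monoʳ-≤ r u≤) (s≤s⁻¹ r+m<)

  cycleSegment : ∀ r m → m < len C → r + suc m ≤ suc (len C) →
    DiPath D (cycleAt r) (cycleAt (r + suc m))
  cycleSegment r m m< r+m< =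
    castPath (cong cycleAt (+-identityʳ r)) refl
      (mkDiPath (λ t → cycleAt (r + t)) m (cycleSegment-injective m< r+m<) segment-arc)
    where
    segment-arc : ∀ {t} → t ≤ m → Arc D (cycleAt (r + t)) (cycleAt (r + suc t))
    segment-arc {t} t≤ = subst (λ u → Arc D (cycleAt (r + t)) (cycleAt u)) (sym (+-suc r t))
      (cycleAt-arc (≤-trans (+-monoʳ-≤ r t≤) (s≤s⁻¹ (subst (_≤ suc (len C)) (+-suc r m) r+m<))))

  internal-cycleSegment : ∀ r m m< r+m< (i : Fin m) →
    internal (cycleSegment r m m< r+m<) i ≡ cycleAt (r + suc (toℕ i))
  internal-cycleSegment r m m< r+m< i = cong (λ t → cycleAt (r + suc t)) (toℕ-inject₁ i)

module _ {D : Digraph} where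

  rotate : DiCycle D → DiCycle D
  rotate C = record
    { len   = len C
    ; vert  = λ i → cycleAt C (suc (toℕ i))
    ; inj   = λ {i} {j} eq → toℕ-injective (cycleAt-injective⁺ C (bound i) (bound j) eq)
    ; step  = λ i → subst (λ t → Arc D (cycleAt C (suc t)) (cycleAt C (suc (suc (toℕ i)))))
                      (sym (toℕ-inject₁ i)) (cycleAt-arc C (toℕ<n i))
    ; close = subst (λ v → Arc D v (cycleAt C 1))
                (trans (sym (cycleAt-wrap C)) (cong (λ t → cycleAt C (suc t)) (sym (toℕ-fromℕ (len C)))))
                (cycleAt-arc C z≤n)
    }
    where
    bound : ∀ {n} (i : Fin (suc n)) → toℕ i ≤ n
    bound i = s≤s⁻¹ (toℕ<n i)

  rotateBy : ℕ → DiCycle D → DiCycle D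
  rotateBy zero    C = C
  rotateBy (suc s) C = rotateBy s (rotate C)

  cycleAt-rotate : ∀ C {t} → t ≤ len C → cycleAt (rotate C) t ≡ cycleAt C (suc t)
  cycleAt-rotate C t≤ = cong (λ s → cycleAt C (suc s)) (toℕ-clamp t≤)

  cycleAt-rotateBy : ∀ s C {t} → s + t ≤ suc (len C) → cycleAt (rotateBy s C) t ≡ cycleAt C (s + t)
  cycleAt-rotateBy zero    C _     = refl
  cycleAt-rotateBy (suc s) C {t} s+t≤ = begin
    cycleAt (rotateBy s (rotate C)) t ≡⟨ cycleAt-rotateBy s (rotate C) (m≤n⇒m≤1+n (s≤s⁻¹ s+t≤)) ⟩
    cycleAt (rotate C) (s + t)        ≡⟨ cycleAt-rotate C (s≤s⁻¹ s+t≤) ⟩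
    cycleAt C (suc s + t)             ∎
    where open ≡-Reasoning

  vert-rotateBy : ∀ s C j → ∃ λ j' → vert (rotateBy s C) j ≡ vert C j'
  vert-rotateBy zero    C j = j , refl
  vert-rotateBy (suc s) C j = let (j' , eq) = vert-rotateBy s (rotate C) j in _ , eq

  rotateBy-start : ∀ C (i : Fin (suc (len C))) → vert (rotateBy (toℕ i) C) zero ≡ vert C i
  rotateBy-start C i = begin
    cycleAt (rotateBy (toℕ i) C) 0 ≡⟨ cycleAt-rotateBy (toℕ i) C
                                        (≤-trans (≤-reflexive (+-identityʳ (toℕ i))) (<⇒≤ (toℕ<n i))) ⟩
    cycleAt C (toℕ i + 0)          ≡⟨ cong (cycleAt C) (+-identityʳ (toℕ i)) ⟩
    cycleAt C (toℕ i)              ≡⟨ sym (vert≡cycleAt C i) ⟩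
    vert C i                       ∎
    where open ≡-Reasoning

module _ {D : Digraph} {a b : Vert D} (Q : DiPath D a b) where

  private
    span : ∀ {r s} → r < s → r + suc (s ∸ r ∸ 1) ≡ s
    span {r} {s} r<s =
      trans (cong (r +_) (trans (+-comm 1 (s ∸ r ∸ 1)) (m∸n+n≡m (m<n⇒0<n∸m r<s)))) (m+[n∸m]≡n (<⇒≤ r<s))

  subpath : ∀ {r s} → r < s → s ≤ suc (inner Q) → DiPath D (pathAt Q r) (pathAt Q s)
  subpath {r} {s} r<s s≤ = castPath (cong (pathAt Q) (+-identityʳ r)) (cong (pathAt Q) (span r<s))
    (mkDiPath (λ t → pathAt Q (r + t)) (s ∸ r ∸ 1) injective arc′)
    where
    bound : ∀ {t} → t ≤ suc (s ∸ r ∸ 1) → r + t ≤ suc (inner Q)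
    bound t≤ = ≤-trans (≤-trans (+-monoʳ-≤ r t≤) (≤-reflexive (span r<s))) s≤
    injective : ∀ {t t'} → t ≤ suc (s ∸ r ∸ 1) → t' ≤ suc (s ∸ r ∸ 1) →
                pathAt Q (r + t) ≡ pathAt Q (r + t') → t ≡ t'
    injective {t} {t'} t≤ t'≤ eq = +-cancelˡ-≡ r t t' (pathAt-injective Q (bound t≤) (bound t'≤) eq)
    arc′ : ∀ {t} → t ≤ s ∸ r ∸ 1 → Arc D (pathAt Q (r + t)) (pathAt Q (r + suc t))
    arc′ {t} t≤ = subst (λ u → Arc D (pathAt Q (r + t)) (pathAt Q u)) (sym (+-suc r t))
      (pathAt-arc Q (s≤s⁻¹ (subst (_≤ suc (inner Q)) (+-suc r t) (bound (s≤s t≤)))))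

  internal-subpath : ∀ {r s} (r<s : r < s) (s≤ : s ≤ suc (inner Q)) j →
    internal (subpath r<s s≤) j ≡ pathAt Q (r + suc (toℕ j)) × r + suc (toℕ j) < s
  internal-subpath {r} {s} r<s s≤ j =
    cong (λ t → pathAt Q (r + suc t)) (toℕ-inject₁ j) ,
    ≤-trans (≤-reflexive (sym (+-suc r (suc (toℕ j)))))
            (≤-trans (+-monoʳ-≤ r (s≤s (toℕ<n j))) (≤-reflexive (span r<s)))

  pathAt-internal : ∀ {m} (m< : m < inner Q) → pathAt Q (suc m) ≡ internal Q (fromℕ< m<)
  pathAt-internal m< = sym (trans (internal≡pathAt Q _) (cong (λ t → pathAt Q (suc t)) (toℕ-fromℕ< m<)))

-- Greedy acyclic colouring

anyFunction? : ∀ {m N} {P : (Fin m → Fin N) → Set} →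
  (∀ {f g} → (∀ i → f i ≡ g i) → P f → P g) → (∀ f → Dec (P f)) → Dec (∃ P)
anyFunction? {zero} P-resp P? with P? (λ ())
... | yes p = yes (_ , p)
... | no ¬p = no λ (f , pf) → ¬p (P-resp (λ ()) pf)
anyFunction? {suc m} {P = P} P-resp P?
  with any? (λ a → anyFunction? (λ f≗g → P-resp (λ { zero → refl ; (suc i) → f≗g i })) (λ g → P? (a ∷ g)))
... | yes (a , g , p) = yes (a ∷ g , p)
... | no ¬q = no λ (f , pf) → ¬q (f zero , tail f , P-resp (λ { zero → refl ; (suc i) → refl }) pf)

arc? : (D : Digraph) (u v : Vert D) → Dec (Arc D u v)
arc? D u v = arc D u v ≟ᵇ true

CycleThrough : (D : Digraph) → Vert D → (Vert D → Set) → Set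
CycleThrough D x A = Σ (DiCycle D) λ C → vert C zero ≡ x × (∀ j → A (vert C (suc j)))

module _ (D : Digraph) (x : Vert D) {A : Vert D → Set} (A? : Decidable A) where

  private
    IsCycleThrough : (l : ℕ) → (Fin (suc l) → Vert D) → Set
    IsCycleThrough l v =
      v zero ≡ x × (∀ i j → v i ≡ v j → i ≡ j) × (∀ i → Arc D (v (inject₁ i)) (v (suc i))) ×
      Arc D (v (fromℕ l)) (v zero) × (∀ j → A (v (suc j)))

    isCycleThrough? : ∀ l v → Dec (IsCycleThrough l v)
    isCycleThrough? l v =
      (v zero ≟ᶠ x) ×-dec all? (λ i → all? (λ j → (v i ≟ᶠ v j) →-dec (i ≟ᶠ j))) ×-dec
      all? (λ i → arc? D _ _) ×-dec arc? D _ _ ×-dec all? (λ j → A? (v (suc j)))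

    isCycleThrough-resp : ∀ {l v w} → (∀ i → v i ≡ w i) → IsCycleThrough l v → IsCycleThrough l w
    isCycleThrough-resp v≗w (v₀≡x , v-inj , v-step , v-close , v∈A) =
      trans (sym (v≗w zero)) v₀≡x ,
      (λ i j eq → v-inj i j (trans (v≗w i) (trans eq (sym (v≗w j))))) ,
      (λ i → subst₂ (Arc D) (v≗w _) (v≗w _) (v-step i)) ,
      subst₂ (Arc D) (v≗w _) (v≗w _) v-close ,
      (λ j → subst A (v≗w (suc j)) (v∈A j))

    toCycle : (∃ λ l → l < size D × ∃ (IsCycleThrough l)) → CycleThrough D x A
    toCycle (l , _ , v , v₀≡x , v-inj , v-step , v-close , v∈A) =
      record { len = l ; vert = v ; inj = λ {i} {j} → v-inj i j ; step = v-step ; close = v-close } ,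
      v₀≡x , v∈A

    fromCycle : CycleThrough D x A → ∃ λ l → l < size D × ∃ (IsCycleThrough l)
    fromCycle (C , C₀≡x , C∈A) =
      len C , injective⇒≤ (inj C) , vert C , C₀≡x , (λ i j → inj C) , step C , close C , C∈A

  cycleThrough? : Dec (CycleThrough D x A)
  cycleThrough? = map′ toCycle fromCycle
    (anyUpTo? (λ l → anyFunction? isCycleThrough-resp (isCycleThrough? l)) (size D))

len-positive : ∀ {D} (C : DiCycle D) → 1 ≤ len C
len-positive {D} record { len = zero ; vert = v ; close = v₀→v₀ } =
  contradiction (trans (sym v₀→v₀) (loopless D (v zero))) λ ()
len-positive record { len = suc _ } = s≤s z≤n

argmax : ∀ m (f : Fin (suc m) → ℕ) → Σ (Fin (suc m)) λ i → ∀ j → f j ≤ f i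
argmax zero    f = zero , λ { zero → ≤-refl }
argmax (suc m) f with argmax m (λ j → f (suc j))
... | i , f≤fi with f zero ≤? f (suc i)
...   | yes f0≤ = suc i , λ { zero → f0≤ ; (suc j) → f≤fi j }
...   | no  f0≰ = zero , λ { zero → ≤-refl ; (suc j) → ≤-trans (f≤fi j) (<⇒≤ (≰⇒> f0≰)) }

firstFailure : {Q : ℕ → Set} → Decidable Q → ℕ → ℕ
firstFailure Q? zero    = zero
firstFailure Q? (suc b) with Q? 0
... | yes _ = suc (firstFailure (λ c → Q? (suc c)) b)
... | no  _ = zero

firstFailure-≤ : ∀ {Q : ℕ → Set} (Q? : Decidable Q) b → firstFailure Q? b ≤ b
firstFailure-≤ Q? zero    = z≤n
firstFailure-≤ Q? (suc b) with Q? 0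
... | yes _ = s≤s (firstFailure-≤ (λ c → Q? (suc c)) b)
... | no  _ = z≤n

firstFailure-minimal : ∀ {Q : ℕ → Set} (Q? : Decidable Q) b {c} → c < firstFailure Q? b → Q c
firstFailure-minimal Q? (suc b) {c} c< with Q? 0
firstFailure-minimal Q? (suc b) {zero}  c<       | yes q₀ = q₀
firstFailure-minimal Q? (suc b) {suc c} (s≤s c<) | yes _  = firstFailure-minimal (λ c → Q? (suc c)) b c<

firstFailure-fails : ∀ {Q : ℕ → Set} (Q? : Decidable Q) b → ¬ Q b → ¬ Q (firstFailure Q? b)
firstFailure-fails Q? zero    ¬q = ¬q
firstFailure-fails Q? (suc b) ¬q with Q? 0
... | yes _  = firstFailure-fails (λ c → Q? (suc c)) b ¬q
... | no ¬q₀ = ¬q₀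

-- The entries of table m at positions m and beyond are junk.
module CourseOfValues {A : Set} (default : A) (compute : ℕ → (ℕ → A) → A) where

  table : ℕ → ℕ → A
  table zero    _ = default
  table (suc m) y with y <? m
  ... | yes _ = table m y
  ... | no  _ = compute m (table m)

  value : ℕ → A
  value y = table (suc y) y

  value-step : ∀ y → value y ≡ compute y (table y)
  value-step y with y <? y
  ... | yes y<y = contradiction y<y (<-irrefl refl)
  ... | no  _   = refl

  table-value : ∀ {m y} → y < m → table m y ≡ value y
  table-value {suc m} {y} y<1+m with y <? m
  ... | yes y<m = table-value y<m
  ... | no  y≮m with ≤-antisym (s≤s⁻¹ y<1+m) (≮⇒≥ y≮m)
  ...   | refl = sym (value-step y)

module GreedyColouring (D : Digraph) where

  EarlierOfColour : (ℕ → ℕ) → Vert D → ℕ → Vert D → Set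
  EarlierOfColour g x c y = toℕ y < toℕ x × g (toℕ y) ≡ c

  earlierOfColour? : ∀ g x c → Decidable (EarlierOfColour g x c)
  earlierOfColour? g x c y = (toℕ y <? toℕ x) ×-dec (g (toℕ y) ≟ c)

  cycleOfColour? : ∀ x g c → Dec (CycleThrough D x (EarlierOfColour g x c))
  cycleOfColour? x g c = cycleThrough? D x (earlierOfColour? g x c)

  newColour : Vert D → (ℕ → ℕ) → ℕ
  newColour x g = firstFailure (cycleOfColour? x g) (toℕ x)

  colourStep : ℕ → (ℕ → ℕ) → ℕ
  colourStep j g with j <? size D
  ... | yes j< = newColour (fromℕ< j<) g
  ... | no  _  = 0

  colourStep-vertex : ∀ x g → colourStep (toℕ x) g ≡ newColour x g
  colourStep-vertex x g with toℕ x <? size D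
  ... | yes x< = cong (λ y → newColour y g) (fromℕ<-toℕ x x<)
  ... | no  x≮ = contradiction (toℕ<n x) x≮

  open CourseOfValues 0 colourStep

  colour : Vert D → ℕ
  colour x = value (toℕ x)

  colour-newColour : ∀ x → colour x ≡ newColour x (table (toℕ x))
  colour-newColour x = trans (value-step (toℕ x)) (colourStep-vertex x (table (toℕ x)))

  colour-≤ : ∀ x → colour x ≤ toℕ x
  colour-≤ x = subst (_≤ toℕ x) (sym (colour-newColour x))
    (firstFailure-≤ (cycleOfColour? x (table (toℕ x))) (toℕ x))

  earlierOfColour-colour : ∀ {x c y} → EarlierOfColour (table (toℕ x)) x c y → toℕ y < toℕ x × colour y ≡ c
  earlierOfColour-colour (y< , eq) = y< , trans (sym (table-value y<)) eq

  cycleOfSmallerColour : ∀ x {c} → c < colour x → CycleThrough D x (λ y → colour y ≡ c)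
  cycleOfSmallerColour x c< =
    let (C , C₀≡x , C∈A) = firstFailure-minimal (cycleOfColour? x (table (toℕ x))) (toℕ x)
                             (subst (_ <_) (colour-newColour x) c<)
    in C , C₀≡x , λ j → proj₂ (earlierOfColour-colour (C∈A j))

  noCycleOfOwnColour : ∀ x → ¬ CycleThrough D x (λ y → toℕ y < toℕ x × colour y ≡ colour x)
  noCycleOfOwnColour x (C , C₀≡x , C∈A) =
    firstFailure-fails (cycleOfColour? x (table (toℕ x))) (toℕ x) noCycleOfColourIndex
      (C , C₀≡x , λ j → let (y< , eq) = C∈A j in y< , trans (table-value y<) (trans eq (colour-newColour x)))
    where
    noCycleOfColourIndex : ¬ CycleThrough D x (EarlierOfColour (table (toℕ x)) x (toℕ x))
    noCycleOfColourIndex (C' , _ , C'∈A) =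
      let (y< , colour≡x) = earlierOfColour-colour (C'∈A (fromℕ< (len-positive C')))
      in <⇒≢ (≤-<-trans (colour-≤ _) y<) colour≡x

  colour-acyclic : ∀ (C : DiCycle D) {c} → ¬ (∀ i → colour (vert C i) ≡ c)
  colour-acyclic C mono = noCycleOfOwnColour x (C' , rotateBy-start C i , earlierOfSameColour)
    where
    latest : Σ (Fin (suc (len C))) λ i → ∀ j → toℕ (vert C j) ≤ toℕ (vert C i)
    latest = argmax (len C) (λ i → toℕ (vert C i))
    i : Fin (suc (len C))
    i = proj₁ latest
    x : Vert D
    x = vert C i
    C' : DiCycle D
    C' = rotateBy (toℕ i) C
    earlierOfSameColour : ∀ j → toℕ (vert C' (suc j)) < toℕ x × colour (vert C' (suc j)) ≡ colour x
    earlierOfSameColour j =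
      let (j' , eq) = vert-rotateBy (toℕ i) C (suc j) in
      ≤∧≢⇒< (subst (λ v → toℕ v ≤ toℕ x) (sym eq) (proj₂ latest j'))
            (λ same → contradiction (inj C' (trans (toℕ-injective same) (sym (rotateBy-start C i)))) λ ()) ,
      trans (cong colour eq) (trans (mono j') (sym (mono i)))

  vertexOfHighColour : ∀ {n} → 1 ≤ n → DichromaticAtLeast D n → ∃ λ x → n ∸ 1 ≤ colour x
  vertexOfHighColour {n} 1≤n χ≥n with any? (λ x → n ∸ 1 ≤? colour x)
  ... | yes found = found
  ... | no  none  = contradiction (colouring , acyclic) (χ≥n (n ∸ 1) (∸-monoʳ-< {n} {1} {0} (s≤s z≤n) 1≤n))
    where
    small : ∀ x → colour x < n ∸ 1
    small x = ≰⇒> (λ big → none (x , big))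
    colouring : Vert D → Fin (n ∸ 1)
    colouring x = fromℕ< (small x)
    acyclic : ∀ (C : DiCycle D) c → ¬ (∀ i → colouring (vert C i) ≡ c)
    acyclic C c mono = colour-acyclic C (λ i → trans (sym (toℕ-fromℕ< (small (vert C i)))) (cong toℕ (mono i)))

-- Ordering a tree from a root

Adj-sym : ∀ {G u v} → Adj G u v → Adj G v u
Adj-sym {G} {u} {v} u~v = trans (adj-sym G v u) u~v

crossing : ∀ {m} {P : Fin (suc m) → Set} → Decidable P → P zero → ¬ P (fromℕ m) →
  ∃ λ (i : Fin m) → P (inject₁ i) × ¬ P (suc i)
crossing {zero}  P? p₀ ¬pₘ = contradiction p₀ ¬pₘ
crossing {suc m} P? p₀ ¬pₘ with P? (suc zero)
... | no ¬p₁ = zero , p₀ , ¬p₁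
... | yes p₁ = let (i , pᵢ , ¬pᵢ₊₁) = crossing (λ i → P? (suc i)) p₁ ¬pₘ in suc i , pᵢ , ¬pᵢ₊₁

extend : ∀ {A : Set} → (ℕ → A) → ℕ → A → ℕ → A
extend f s a j with j <? s
... | yes _ = f j
... | no  _ = a

module _ {A : Set} {f : ℕ → A} {s : ℕ} {a : A} where

  extend-old : ∀ {j} → j < s → extend f s a j ≡ f j
  extend-old {j} j<s with j <? s
  ... | yes _   = refl
  ... | no  j≮s = contradiction j<s j≮s

  extend-new : extend f s a s ≡ a
  extend-new with s <? s
  ... | yes s<s = contradiction s<s (<-irrefl refl)
  ... | no  _   = refl

record PathWithin (G : Graph) (P : GVert G → Set) (x y : GVert G) : Set where
  field
    hops           : ℕ
    node           : ℕ → GVert G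
    node-start     : node 0 ≡ x
    node-end       : node hops ≡ y
    node-injective : ∀ {a b} → a ≤ hops → b ≤ hops → node a ≡ node b → a ≡ b
    node-adj       : ∀ {r} → r < hops → Adj G (node r) (node (suc r))
    node-within    : ∀ {r} → r ≤ hops → P (node r)
open PathWithin

module _ {G : Graph} where

  trivialPath : ∀ {P x} → P x → PathWithin G P x x
  trivialPath {x = x} px = record
    { hops = 0 ; node = λ _ → x ; node-start = refl ; node-end = refl
    ; node-injective = λ { z≤n z≤n _ → refl } ; node-adj = λ () ; node-within = λ _ → px }

  reversePath : ∀ {P x y} → PathWithin G P x y → PathWithin G P y x
  reversePath p = record
    { hops           = hops p
    ; node           = λ r → node p (hops p ∸ r)
    ; node-start     = node-end p
    ; node-end       = trans (cong (node p) (n∸n≡0 (hops p))) (node-start p)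
    ; node-injective = λ {a} {b} a≤ b≤ eq →
                         ∸-cancelˡ-≡ a≤ b≤ (node-injective p (m∸n≤m (hops p) a) (m∸n≤m (hops p) b) eq)
    ; node-adj       = λ {r} r< → Adj-sym {G} (subst (λ t → Adj G (node p (hops p ∸ suc r)) (node p t))
                         (sym (+-∸-assoc 1 r<)) (node-adj p (∸-monoʳ-< {hops p} {suc r} {0} (s≤s z≤n) r<)))
    ; node-within    = λ {r} _ → node-within p (m∸n≤m (hops p) r)
    }

  weakenPath : ∀ {P Q x y} → (∀ {v} → P v → Q v) → PathWithin G P x y → PathWithin G Q x y
  weakenPath P⊆Q p = record
    { hops = hops p ; node = node p ; node-start = node-start p ; node-end = node-end p
    ; node-injective = node-injective p ; node-adj = node-adj p ; node-within = λ r≤ → P⊆Q (node-within p r≤) }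

  prependPath : ∀ {P Q x y z} → (∀ {v} → P v → Q v) → Q z → ¬ P z → Adj G z x →
    PathWithin G P x y → PathWithin G Q z y
  prependPath {P} {Q} {x} {y} {z} P⊆Q qz ¬pz z~x p = record
    { hops = suc (hops p) ; node = node′ ; node-start = refl ; node-end = node-end p
    ; node-injective = injective′ ; node-adj = adj′ ; node-within = within′ }
    where
    node′ : ℕ → GVert G
    node′ zero    = z
    node′ (suc r) = node p r
    injective′ : ∀ {a b} → a ≤ suc (hops p) → b ≤ suc (hops p) → node′ a ≡ node′ b → a ≡ b
    injective′ {zero}  {zero}  _ _ _ = refl
    injective′ {zero}  {suc b} _ b≤ eq = contradiction (subst P (sym eq) (node-within p (s≤s⁻¹ b≤))) ¬pz
    injective′ {suc a} {zero}  a≤ _ eq = contradiction (subst P eq (node-within p (s≤s⁻¹ a≤))) ¬pz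
    injective′ {suc a} {suc b} a≤ b≤ eq = cong suc (node-injective p (s≤s⁻¹ a≤) (s≤s⁻¹ b≤) eq)
    adj′ : ∀ {r} → r < suc (hops p) → Adj G (node′ r) (node′ (suc r))
    adj′ {zero}  _  = subst (Adj G z) (sym (node-start p)) z~x
    adj′ {suc r} r< = node-adj p (s≤s⁻¹ r<)
    within′ : ∀ {r} → r ≤ suc (hops p) → Q (node′ r)
    within′ {zero}  _  = qz
    within′ {suc r} r≤ = P⊆Q (node-within p (s≤s⁻¹ r≤))

  hops-positive : ∀ {P x y} (p : PathWithin G P x y) → x ≢ y → 1 ≤ hops p
  hops-positive p x≢y = n≢0⇒n>0 λ hops≡0 →
    x≢y (trans (sym (node-start p)) (trans (cong (node p) (sym hops≡0)) (node-end p)))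

  closePath : ∀ {P x y} → (p : PathWithin G P x y) → 2 ≤ hops p → Adj G y x → GCycle G
  closePath p 2≤ y~x = record
    { clen   = hops p
    ; clen≥2 = 2≤
    ; cvert  = λ i → node p (toℕ i)
    ; cinj   = λ {i} {j} eq → toℕ-injective (node-injective p (bound i) (bound j) eq)
    ; cstep  = λ i → subst (λ t → Adj G (node p t) (node p (suc (toℕ i)))) (sym (toℕ-inject₁ i))
                       (node-adj p (toℕ<n i))
    ; cclose = subst₂ (Adj G) (sym (trans (cong (node p) (toℕ-fromℕ (hops p))) (node-end p))) (sym (node-start p)) y~x
    }
    where
    bound : ∀ {m} (i : Fin (suc m)) → toℕ i ≤ m
    bound i = s≤s⁻¹ (toℕ<n i)

record TreeOrder (G : Graph) : Set where
  field
    index           : GVert G → ℕ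
    index<          : ∀ v → index v < gsize G
    index-injective : ∀ {u v} → index u ≡ index v → u ≡ v
    parent          : ℕ → ℕ
    parent<         : ∀ {j} → 1 ≤ j → j < gsize G → parent j < j
    parent-index    : ∀ {u v} → Adj G u v → index u < index v → parent (index v) ≡ index u

module _ (G : Graph) (tree : IsTree G) where

  private
    V : Set
    V = GVert G
    n : ℕ
    n = gsize G
    1≤n : 1 ≤ n
    1≤n = proj₁ tree
    walk : ∀ u v → Walk G u v
    walk = proj₁ (proj₂ tree)
    acyclic : ¬ GCycle G
    acyclic = proj₂ (proj₂ tree)

  Placed : (ℕ → V) → ℕ → V → Set
  Placed order s x = Σ (Fin s) λ i → order (toℕ i) ≡ x

  placed? : ∀ order s → Decidable (Placed order s)
  placed? order s x = any? (λ i → order (toℕ i) ≟ᶠ x)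

  record Stage (s : ℕ) : Set where
    field
      order           : ℕ → V
      order-injective : ∀ {i j} → i < s → j < s → order i ≡ order j → i ≡ j
      parent          : ℕ → ℕ
      parent<         : ∀ {j} → 1 ≤ j → j < s → parent j < j
      parent-unique   : ∀ {i j} → i < j → j < s → Adj G (order i) (order j) → parent j ≡ i
      connected       : ∀ {x y} → Placed order s x → Placed order s y → PathWithin G (Placed order s) x y

  firstStage : Stage 1
  firstStage = record
    { order           = λ _ → root
    ; order-injective = λ { (s≤s z≤n) (s≤s z≤n) _ → refl }
    ; parent          = λ _ → 0
    ; parent<         = λ { (s≤s z≤n) (s≤s ()) }
    ; parent-unique   = λ { i<j (s≤s z≤n) _ → contradiction i<j λ () }
    ; connected       = λ { (zero , refl) (zero , refl) → trivialPath (zero , refl) }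
    }
    where
    root : V
    root = fromℕ< 1≤n

  module NextStage {s} (s<n : s < n) (st : Stage s) (1≤s : 1 ≤ s) where
    open Stage st
    open Walk

    placedAt : ∀ {i} → i < s → Placed order s (order i)
    placedAt i<s = fromℕ< i<s , cong order (toℕ-fromℕ< i<s)

    unplaced : ∃ λ z → ¬ Placed order s z
    unplaced with any? (λ z → ¬? (placed? order s z))
    ... | yes found = found
    ... | no  none  = contradiction (injective⇒≤ position-injective) (<⇒≱ s<n)
      where
      placed : ∀ z → Placed order s z
      placed z = decidable-stable (placed? order s z) (λ ¬p → none (z , ¬p))
      position-injective : Injective _≡_ _≡_ (λ z → proj₁ (placed z))
      position-injective {z} {z'} eq =
        trans (sym (proj₂ (placed z))) (trans (cong (λ i → order (toℕ i)) eq) (proj₂ (placed z')))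

    w : Walk G (order 0) (proj₁ unplaced)
    w = walk (order 0) (proj₁ unplaced)

    leavingArc : ∃ λ e → Placed order s (wvert w (inject₁ e)) × ¬ Placed order s (wvert w (suc e))
    leavingArc = crossing (λ i → placed? order s (wvert w i))
      (subst (Placed order s) (sym (wstart w)) (placedAt 1≤s))
      (λ placed-end → proj₂ unplaced (subst (Placed order s) (wend w) placed-end))

    e : Fin (wlen w)
    e = proj₁ leavingArc
    p : Fin s
    p = proj₁ (proj₁ (proj₂ leavingArc))
    z : V
    z = wvert w (suc e)

    z-new : ¬ Placed order s z
    z-new = proj₂ (proj₂ leavingArc)

    z~p : Adj G z (order (toℕ p))
    z~p = Adj-sym {G} (subst (λ v → Adj G v z) (sym (proj₂ (proj₁ (proj₂ leavingArc)))) (wstep w e))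

    order′ : ℕ → V
    order′ = extend order s z

    parent′ : ℕ → ℕ
    parent′ = extend parent s (toℕ p)

    order′-old : ∀ {j} → j < s → order′ j ≡ order j
    order′-old = extend-old

    order′-new : order′ s ≡ z
    order′-new = extend-new {f = order} {s = s}

    parent′-old : ∀ {j} → j < s → parent′ j ≡ parent j
    parent′-old = extend-old

    parent′-new : parent′ s ≡ toℕ p
    parent′-new = extend-new {f = parent} {s = s}

    split : ∀ {j} → j < suc s → j < s ⊎ j ≡ s
    split j< = m≤n⇒m<n∨m≡n (s≤s⁻¹ j<)

    old⊆new : ∀ {x} → Placed order s x → Placed order′ (suc s) x
    old⊆new (i , eq) = inject₁ i , trans (cong order′ (toℕ-inject₁ i)) (trans (order′-old (toℕ<n i)) eq)

    z-placed : Placed order′ (suc s) z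
    z-placed = fromℕ s , trans (cong order′ (toℕ-fromℕ s)) order′-new

    new-placed : ∀ {x} → Placed order′ (suc s) x → Placed order s x ⊎ x ≡ z
    new-placed (i , eq) with split (toℕ<n i)
    ... | inj₁ i<s = inj₁ (fromℕ< i<s , trans (cong order (toℕ-fromℕ< i<s)) (trans (sym (order′-old i<s)) eq))
    ... | inj₂ i≡s = inj₂ (trans (sym eq) (trans (cong order′ i≡s) order′-new))

    order′-injective : ∀ {i j} → i < suc s → j < suc s → order′ i ≡ order′ j → i ≡ j
    order′-injective i< j< eq with split i< | split j<
    ... | inj₁ i<s  | inj₁ j<s  = order-injective i<s j<s (trans (sym (order′-old i<s)) (trans eq (order′-old j<s)))
    ... | inj₂ refl | inj₂ refl = refl
    ... | inj₁ i<s  | inj₂ refl =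
      contradiction (subst (Placed order s) (trans (sym (order′-old i<s)) (trans eq order′-new)) (placedAt i<s)) z-new
    ... | inj₂ refl | inj₁ j<s  =
      contradiction (subst (Placed order s) (trans (sym (order′-old j<s)) (trans (sym eq) order′-new)) (placedAt j<s))
                    z-new

    parent′< : ∀ {j} → 1 ≤ j → j < suc s → parent′ j < j
    parent′< 1≤j j< with split j<
    ... | inj₁ j<s  = subst (_< _) (sym (parent′-old j<s)) (parent< 1≤j j<s)
    ... | inj₂ refl = subst (_< s) (sym parent′-new) (toℕ<n p)

    -- A second placed neighbour of z would close a cycle through z.
    onlyNeighbour : ∀ {i} → i < s → Adj G (order i) z → i ≡ toℕ p
    onlyNeighbour {i} i<s i~z with i ≟ toℕ p
    ... | yes i≡p = i≡p
    ... | no  i≢p = contradiction (closePath viaZ (s≤s (hops-positive pathToI p≢i)) i~z) acyclic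
      where
      p≢i : order (toℕ p) ≢ order i
      p≢i eq = i≢p (sym (order-injective (toℕ<n p) i<s eq))
      pathToI : PathWithin G (Placed order s) (order (toℕ p)) (order i)
      pathToI = connected (p , refl) (placedAt i<s)
      viaZ : PathWithin G (λ _ → ⊤) z (order i)
      viaZ = prependPath (λ _ → tt) tt z-new z~p pathToI

    parent′-unique : ∀ {i j} → i < j → j < suc s → Adj G (order′ i) (order′ j) → parent′ j ≡ i
    parent′-unique i<j j< i~j with split j<
    ... | inj₁ j<s  = trans (parent′-old j<s)
      (parent-unique i<j j<s (subst₂ (Adj G) (order′-old (<-trans i<j j<s)) (order′-old j<s) i~j))
    ... | inj₂ refl = trans parent′-new (sym (onlyNeighbour i<j (subst₂ (Adj G) (order′-old i<j) order′-new i~j)))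

    fromZ : ∀ {y} → Placed order s y → PathWithin G (Placed order′ (suc s)) z y
    fromZ py = prependPath old⊆new z-placed z-new z~p (connected (p , refl) py)

    connected′ : ∀ {x y} → Placed order′ (suc s) x → Placed order′ (suc s) y →
                 PathWithin G (Placed order′ (suc s)) x y
    connected′ px py with new-placed px | new-placed py
    ... | inj₁ px′  | inj₁ py′  = weakenPath old⊆new (connected px′ py′)
    ... | inj₂ refl | inj₂ refl = trivialPath z-placed
    ... | inj₂ refl | inj₁ py′  = fromZ py′
    ... | inj₁ px′  | inj₂ refl = reversePath (fromZ px′)

    next : Stage (suc s)
    next = record
      { order = order′ ; order-injective = order′-injective ; parent = parent′ ; parent< = parent′<
      ; parent-unique = parent′-unique ; connected = connected′ }

  stage : ∀ s → 1 ≤ s → s ≤ n → Stage s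
  stage (suc zero)    _ _  = firstStage
  stage (suc (suc s)) _ s< = NextStage.next s< (stage (suc s) (s≤s z≤n) (<⇒≤ s<)) (s≤s z≤n)

  treeOrder : TreeOrder G
  treeOrder = record
    { index = index ; index< = λ v → toℕ<n (proj₁ (allPlaced v)) ; index-injective = index-injective
    ; parent = parent ; parent< = parent<
    ; parent-index = λ {u} {v} u~v u<v → parent-unique u<v (toℕ<n (proj₁ (allPlaced v)))
        (subst₂ (Adj G) (sym (proj₂ (allPlaced u))) (sym (proj₂ (allPlaced v))) u~v)
    }
    where
    open Stage (stage n 1≤n ≤-refl)
    allPlaced : ∀ v → Placed order n v
    allPlaced v = decidable-stable (placed? order n v) λ ¬placed →
      contradiction (injective⇒≤ (withV-injective ¬placed)) 1+n≰n
      where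
      withV : Fin (suc n) → V
      withV zero    = v
      withV (suc i) = order (toℕ i)
      withV-injective : ¬ Placed order n v → Injective _≡_ _≡_ withV
      withV-injective _ {zero}  {zero}  _  = refl
      withV-injective ¬placed {zero}  {suc j} eq = contradiction (j , sym eq) ¬placed
      withV-injective ¬placed {suc i} {zero}  eq = contradiction (i , eq) ¬placed
      withV-injective _ {suc i} {suc j} eq = cong suc (toℕ-injective (order-injective (toℕ<n i) (toℕ<n j) eq))
    index : V → ℕ
    index v = toℕ (proj₁ (allPlaced v))
    index-injective : ∀ {u v} → index u ≡ index v → u ≡ v
    index-injective {u} {v} eq = trans (sym (proj₂ (allPlaced u))) (trans (cong order eq) (proj₂ (allPlaced v)))

-- Embedding a subdivided bidirected tree

record SubdividedDigon (D : Digraph) (ℓ : ℕ) (A : Vert D → Set) (x y : Vert D) : Set where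
  field
    y∈A                 : A y
    forth               : DiPath D x y
    back                : DiPath D y x
    forth-long          : ℓ ≤ inner forth
    back-long           : ℓ ≤ inner back
    forth-internal∈A    : ∀ i → A (internal forth i)
    back-internal∈A     : ∀ i → A (internal back i)
    forth-internal≢y    : ∀ i → internal forth i ≢ y
    back-internal≢y     : ∀ i → internal back i ≢ y
    forth-back-disjoint : ∀ i j → internal forth i ≢ internal back j

module _ {D : Digraph} {ℓ : ℕ} {x : Vert D} {A : Vert D → Set}
  (C : DiCycle D) (C₀≡x : vert C zero ≡ x) (C∈A : ∀ j → A (vert C (suc j))) where

  private
    L : ℕ
    L = len C

    cycleAt∈A : ∀ {t} → t < L → A (cycleAt C (suc t))
    cycleAt∈A t< = subst A (cong (vert C) (sym clamp≡)) (C∈A (fromℕ< t<))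
      where
      clamp≡ : clamp L (suc _) ≡ suc (fromℕ< t<)
      clamp≡ = toℕ-injective (trans (toℕ-clamp t<) (cong suc (sym (toℕ-fromℕ< t<))))

    cycleAt-distinct : ∀ {s t} → s < L → t < L → s ≢ t → cycleAt C (suc s) ≢ cycleAt C (suc t)
    cycleAt-distinct s< t< s≢t eq = s≢t (suc-injective (cycleAt-injective C s< t< eq))

  cycle⇒digon : 2 * suc ℓ ≤ cycleLength C → SubdividedDigon D ℓ A x (cycleAt C (suc ℓ))
  cycle⇒digon long = record
    { y∈A                 = cycleAt∈A ℓ<L
    ; forth               = forth
    ; back                = back
    ; forth-long          = ≤-refl
    ; back-long           = m+n≤o⇒m≤o∸n ℓ core
    ; forth-internal∈A    = λ i → subst A (sym (forth-at i)) (cycleAt∈A (forth-pos< i))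
    ; back-internal∈A     = λ j → subst A (sym (back-at j)) (cycleAt∈A (back-pos< j))
    ; forth-internal≢y    = λ i eq → cycleAt-distinct (forth-pos< i) ℓ<L (<⇒≢ (toℕ<n i))
                                       (trans (sym (forth-at i)) eq)
    ; back-internal≢y     = λ j eq → cycleAt-distinct (back-pos< j) ℓ<L (λ eq → <⇒≢ ℓ<back (sym eq))
                                       (trans (sym (back-at j)) eq)
    ; forth-back-disjoint = λ i j eq → cycleAt-distinct (forth-pos< i) (back-pos< j)
                              (<⇒≢ (<-trans (toℕ<n i) ℓ<back)) (trans (sym (forth-at i)) (trans eq (back-at j)))
    }
    where
    core : ℓ + suc ℓ ≤ L
    core = subst (λ m → ℓ + suc m ≤ L) (+-identityʳ ℓ) (s≤s⁻¹ long)
    ℓ<L : ℓ < L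
    ℓ<L = m+n≤o⇒n≤o ℓ core
    back-end : suc ℓ + suc (L ∸ suc ℓ) ≡ suc L
    back-end = trans (+-suc (suc ℓ) (L ∸ suc ℓ)) (cong suc (m+[n∸m]≡n ℓ<L))
    short₂ : L ∸ suc ℓ < L
    short₂ = ∸-monoʳ-< {L} {suc ℓ} {0} (s≤s z≤n) ℓ<L
    segment₁ : DiPath D (cycleAt C 0) (cycleAt C (suc ℓ))
    segment₁ = cycleSegment C 0 ℓ ℓ<L (s≤s (<⇒≤ ℓ<L))
    segment₂ : DiPath D (cycleAt C (suc ℓ)) (cycleAt C (suc ℓ + suc (L ∸ suc ℓ)))
    segment₂ = cycleSegment C (suc ℓ) (L ∸ suc ℓ) short₂ (≤-reflexive back-end)
    forth : DiPath D x (cycleAt C (suc ℓ))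
    forth = castPath C₀≡x refl segment₁
    back : DiPath D (cycleAt C (suc ℓ)) x
    back = castPath refl (trans (cong (cycleAt C) back-end) (trans (cycleAt-wrap C) C₀≡x)) segment₂
    forth-at : ∀ i → internal forth i ≡ cycleAt C (suc (toℕ i))
    forth-at = internal-cycleSegment C 0 ℓ ℓ<L (s≤s (<⇒≤ ℓ<L))
    back-at : ∀ j → internal back j ≡ cycleAt C (suc (suc ℓ + toℕ j))
    back-at j = trans (internal-cycleSegment C (suc ℓ) (L ∸ suc ℓ) short₂ (≤-reflexive back-end) j)
                      (cong (cycleAt C) (+-suc (suc ℓ) (toℕ j)))
    forth-pos< : ∀ (i : Fin ℓ) → toℕ i < L
    forth-pos< i = <-trans (toℕ<n i) ℓ<L
    back-pos< : ∀ (j : Fin (L ∸ suc ℓ)) → suc ℓ + toℕ j < L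
    back-pos< j = subst (suc ℓ + toℕ j <_) (m+[n∸m]≡n ℓ<L) (+-monoʳ-< (suc ℓ) (toℕ<n j))
    ℓ<back : ∀ {t} → ℓ < suc ℓ + t
    ℓ<back {t} = s≤s (m≤m+n ℓ t)

-- Unlike IsSubdivision, this says nothing about the vertices and arcs of D outside the model.
record SubdivisionModel (F D : Digraph) : Set where
  field
    image           : Vert F → Vert D
    image-injective : ∀ {u v} → image u ≡ image v → u ≡ v
    route           : ∀ u v → Arc F u v → DiPath D (image u) (image v)
    route≢image     : ∀ u v (e : Arc F u v) i w → internal (route u v e) i ≢ image w
    routes-disjoint : ∀ u v (e : Arc F u v) u' v' (e' : Arc F u' v') i i' →
                      internal (route u v e) i ≡ internal (route u' v' e') i' → u ≡ u' × v ≡ v'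
open SubdivisionModel

Adj-irreflexive : ∀ {G u v} → Adj G u v → u ≢ v
Adj-irreflexive {G} {u} u~u refl = contradiction (trans (sym u~u) (irrefl G u)) λ ()

module BidirectedTreeModel (D : Digraph) (G : Graph) (tree : IsTree G) (ℓ : ℕ)
  (χ≥n : DichromaticAtLeast D (gsize G)) (girth : DigirthAtLeast D (2 * suc ℓ)) where

  open GreedyColouring D
  open TreeOrder (treeOrder G tree)

  private
    n : ℕ
    n = gsize G

  target : ℕ → ℕ
  target j = n ∸ suc j

  target-injective : ∀ {j j'} → j < n → j' < n → target j ≡ target j' → j ≡ j'
  target-injective j<n j'<n eq = suc-injective (∸-cancelˡ-≡ j<n j'<n eq)

  target-decreasing : ∀ {i j} → i < j → j < n → target j < target i
  target-decreasing i<j j<n = ∸-monoʳ-< (s≤s i<j) j<n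

  root : Vert D
  root = proj₁ (vertexOfHighColour (proj₁ tree) χ≥n)

  HasColour : ℕ → Vert D → Set
  HasColour c y = colour y ≡ c

  -- Junk value v when no cycle through v has all its other vertices of colour target c.
  pick : Vert D → ℕ → Vert D
  pick v c with cycleThrough? D v (λ y → colour y ≟ target c)
  ... | yes w = cycleAt (proj₁ w) (suc ℓ)
  ... | no  _ = v

  pick-digon : ∀ v c → .(target c < colour v) → SubdividedDigon D ℓ (HasColour (target c)) v (pick v c)
  pick-digon v c gap with cycleThrough? D v (λ y → colour y ≟ target c)
  ... | yes (C , C₀≡x , C∈A) = cycle⇒digon C C₀≡x C∈A (girth C)
  ... | no  none = Irrelevant.⊥-elim (none (cycleOfSmallerColour v gap))

  pick-colour : ∀ {v c} → target c < colour v → colour (pick v c) ≡ target c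
  pick-colour {v} {c} gap = SubdividedDigon.y∈A (pick-digon v c gap)

  siteStep : ℕ → (ℕ → Vert D) → Vert D
  siteStep zero    _    = root
  siteStep (suc j) site = pick (site (parent (suc j))) (suc j)

  open CourseOfValues root siteStep renaming (value to site)

  site-step : ∀ {c} → 1 ≤ c → c < n → site c ≡ pick (site (parent c)) c
  site-step {suc c} 1≤c c<n =
    trans (value-step (suc c)) (cong (λ v → pick v (suc c)) (table-value (parent< 1≤c c<n)))

  site-colour≥ : ∀ j → j < n → target j ≤ colour (site j)
  site-colour≥ = <-rec _ λ where
    zero    _   _   → subst (λ v → target 0 ≤ colour v) (sym (value-step 0))
                              (proj₂ (vertexOfHighColour (proj₁ tree) χ≥n))
    (suc c) rec c<n → let p<c = parent< (s≤s z≤n) c<n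
                          gap = <-≤-trans (target-decreasing p<c c<n) (rec p<c (<-trans p<c c<n))
                      in ≤-reflexive (sym (trans (cong colour (site-step (s≤s z≤n) c<n)) (pick-colour gap)))

  colourGap : ∀ {c} → 1 ≤ c → c < n → target c < colour (site (parent c))
  colourGap 1≤c c<n = let p<c = parent< 1≤c c<n in
    <-≤-trans (target-decreasing p<c c<n) (site-colour≥ _ (<-trans p<c c<n))

  -- The evidence is irrelevant so that the digon of a child c does not depend on how 1 ≤ c and c < n were obtained.
  digon : ∀ c → .(1 ≤ c) → .(c < n) →
    SubdividedDigon D ℓ (HasColour (target c)) (site (parent c)) (pick (site (parent c)) c)
  digon c 1≤c c<n = pick-digon (site (parent c)) c (colourGap 1≤c c<n)

  site-colour : ∀ {c} → 1 ≤ c → c < n → colour (site c) ≡ target c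
  site-colour 1≤c c<n = trans (cong colour (site-step 1≤c c<n)) (pick-colour (colourGap 1≤c c<n))

  site-of-colour : ∀ {c j x} → 1 ≤ c → c < n → colour x ≡ target c → j < n → x ≡ site j → j ≡ c
  site-of-colour {c} {zero} 1≤c c<n x-colour 0<n x≡ = contradiction
    (≤-trans (site-colour≥ 0 0<n) (≤-reflexive (trans (cong colour (sym x≡)) x-colour)))
    (<⇒≱ (target-decreasing 1≤c c<n))
  site-of-colour {c} {suc j} 1≤c c<n x-colour j<n x≡ =
    target-injective j<n c<n (trans (sym (site-colour (s≤s z≤n) j<n)) (trans (cong colour (sym x≡)) x-colour))

  site-injective : ∀ {j j'} → j < n → j' < n → site j ≡ site j' → j ≡ j'
  site-injective {zero}  {zero}   _   _    _  = refl
  site-injective {j}     {suc j'} j<n j'<n eq =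
    site-of-colour (s≤s z≤n) j'<n (site-colour (s≤s z≤n) j'<n) j<n (sym eq)
  site-injective {suc j} {zero}   j<n j'<n eq =
    sym (site-of-colour (s≤s z≤n) j<n (site-colour (s≤s z≤n) j<n) j'<n eq)

  data Orientation (u v : GVert G) : Set where
    downward : index u < index v → parent (index v) ≡ index u → Orientation u v
    upward   : index v < index u → parent (index u) ≡ index v → Orientation u v

  orientation : ∀ {u v} → Adj G u v → Orientation u v
  orientation {u} {v} u~v with <-cmp (index u) (index v)
  ... | tri< u<v _ _ = downward u<v (parent-index u~v u<v)
  ... | tri> _ _ v<u = upward v<u (parent-index (Adj-sym {G} u~v) v<u)
  ... | tri≈ _ u≡v _ = contradiction (index-injective u≡v) (Adj-irreflexive {G} u~v)

  child : ∀ {u v} → Orientation u v → ℕ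
  child {v = v} (downward _ _) = index v
  child {u = u} (upward _ _)   = index u

  positive : ∀ {i j} → i < j → 1 ≤ j
  positive {j = suc _} _ = s≤s z≤n

  routeBy : ∀ {u v} → Orientation u v → DiPath D (site (index u)) (site (index v))
  routeBy {u} {v} (downward u<v parent≡) =
    castPath (cong site parent≡) (sym (site-step (positive u<v) (index< v)))
      (SubdividedDigon.forth (digon (index v) (positive u<v) (index< v)))
  routeBy {u} {v} (upward v<u parent≡) =
    castPath (sym (site-step (positive v<u) (index< u))) (cong site parent≡)
      (SubdividedDigon.back (digon (index u) (positive v<u) (index< u)))

  child-bounds : ∀ {u v} (o : Orientation u v) → 1 ≤ child o × child o < n
  child-bounds {v = v} (downward u<v _) = positive u<v , index< v
  child-bounds {u = u} (upward v<u _)   = positive v<u , index< u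

  routeBy-internal : ∀ {u v} (o : Orientation u v) i →
    colour (internal (routeBy o) i) ≡ target (child o) × internal (routeBy o) i ≢ site (child o)
  routeBy-internal {v = v} (downward u<v _) i =
    forth-internal∈A i , λ eq → forth-internal≢y i (trans eq (site-step (positive u<v) (index< v)))
    where open SubdividedDigon (digon (index v) (positive u<v) (index< v))
  routeBy-internal {u = u} (upward v<u _) i =
    back-internal∈A i , λ eq → back-internal≢y i (trans eq (site-step (positive v<u) (index< u)))
    where open SubdividedDigon (digon (index u) (positive v<u) (index< u))

  routeBy-long : ∀ {u v} (o : Orientation u v) → ℓ ≤ inner (routeBy o)
  routeBy-long {v = v} (downward u<v _) = SubdividedDigon.forth-long (digon (index v) (positive u<v) (index< v))
  routeBy-long {u = u} (upward v<u _)   = SubdividedDigon.back-long (digon (index u) (positive v<u) (index< u))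

  routeBy≢site : ∀ {u v} (o : Orientation u v) i {j} → j < n → internal (routeBy o) i ≢ site j
  routeBy≢site o i j<n eq =
    let (1≤c , c<n) = child-bounds o
        (x-colour , x≢site) = routeBy-internal o i
    in x≢site (trans eq (cong site (site-of-colour 1≤c c<n x-colour j<n eq)))

  routeBy-child : ∀ {u v u' v'} (o : Orientation u v) (o' : Orientation u' v') i i' →
    internal (routeBy o) i ≡ internal (routeBy o') i' → child o ≡ child o'
  routeBy-child o o' i i' eq = target-injective (proj₂ (child-bounds o)) (proj₂ (child-bounds o'))
    (trans (sym (proj₁ (routeBy-internal o i))) (trans (cong colour eq) (proj₁ (routeBy-internal o' i'))))

  forth≢back : ∀ {c c'} .(p : 1 ≤ c) .(q : c < n) .(p' : 1 ≤ c') .(q' : c' < n) → c ≡ c' → ∀ i i' →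
    internal (SubdividedDigon.forth (digon c p q)) i ≢ internal (SubdividedDigon.back (digon c' p' q')) i'
  forth≢back p q _ _ refl = SubdividedDigon.forth-back-disjoint (digon _ p q)

  routeBy-disjoint : ∀ {u v u' v'} (o : Orientation u v) (o' : Orientation u' v') i i' →
    internal (routeBy o) i ≡ internal (routeBy o') i' → u ≡ u' × v ≡ v'
  routeBy-disjoint o@(downward _ p≡) o'@(downward _ p≡') i i' eq =
    let c≡ = routeBy-child o o' i i' eq in
    index-injective (trans (sym p≡) (trans (cong parent c≡) p≡')) , index-injective c≡
  routeBy-disjoint o@(upward _ p≡) o'@(upward _ p≡') i i' eq =
    let c≡ = routeBy-child o o' i i' eq in
    index-injective c≡ , index-injective (trans (sym p≡) (trans (cong parent c≡) p≡'))
  routeBy-disjoint {v = v} {u' = u'} o@(downward u<v _) o'@(upward v'<u' _) i i' eq =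
    contradiction eq (forth≢back (positive u<v) (index< v) (positive v'<u') (index< u') (routeBy-child o o' i i' eq) i i')
  routeBy-disjoint {u = u} {v' = v'} o@(upward v<u _) o'@(downward u'<v' _) i i' eq =
    contradiction (sym eq)
      (forth≢back (positive u'<v') (index< v') (positive v<u) (index< u) (sym (routeBy-child o o' i i' eq)) i' i)

  model : SubdivisionModel (bidirect G) D
  model = record
    { image           = λ v → site (index v)
    ; image-injective = λ eq → index-injective (site-injective (index< _) (index< _) eq)
    ; route           = λ u v u~v → routeBy (orientation u~v)
    ; route≢image     = λ u v u~v i w → routeBy≢site (orientation u~v) i (index< w)
    ; routes-disjoint = λ u v u~v u' v' u'~v' → routeBy-disjoint (orientation u~v) (orientation u'~v')
    }

  model-long : ∀ u v (e : Arc (bidirect G) u v) → ℓ ≤ inner (route model u v e)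
  model-long u v u~v = routeBy-long (orientation u~v)

-- Refining a subdivision

ArcOf : Digraph → Set
ArcOf F = Σ (Vert F) λ u → Σ (Vert F) λ v → Arc F u v

module _ {F D : Digraph} (M : SubdivisionModel F D) where

  route-interior≢image : ∀ {u v e m} w → 1 ≤ m → m ≤ inner (route M u v e) →
                         pathAt (route M u v e) m ≢ image M w
  route-interior≢image {u} {v} {e} {suc m} w _ m< eq =
    route≢image M u v e (fromℕ< m<) w (trans (sym (pathAt-internal (route M u v e) m<)) eq)

  route-interior-injective : ∀ {u v e u' v' e' m m'} →
    1 ≤ m → m ≤ inner (route M u v e) → 1 ≤ m' → m' ≤ inner (route M u' v' e') →
    pathAt (route M u v e) m ≡ pathAt (route M u' v' e') m' →
    _≡_ {A = ArcOf F} (u , v , e) (u' , v' , e') × m ≡ m'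
  route-interior-injective {u} {v} {e} {u'} {v'} {e'} {suc m} {suc m'} _ m< _ m'< eq
    with routes-disjoint M u v e u' v' e' (fromℕ< m<) (fromℕ< m'<)
           (trans (sym (pathAt-internal (route M u v e) m<)) (trans eq (pathAt-internal (route M u' v' e') m'<)))
  ... | refl , refl with Bool-≡-irrelevant e e'
  ...   | refl = refl , pathAt-injective (route M u v e) (s≤s (<⇒≤ m<)) (s≤s (<⇒≤ m'<)) eq

module Refinement {F T D : Digraph} (S : IsSubdivision F T) (M : SubdivisionModel F D)
  (long : ∀ u v e → inner (path S u v e) ≤ inner (route M u v e)) where

  private
    P : ∀ u v → Arc F u v → DiPath T (branch S u) (branch S v)
    P = path S
    Q : ∀ u v → Arc F u v → DiPath D (image M u) (image M v)
    Q = route M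

  vertexImage : Vert T → Vert D
  vertexImage t with covers-vertices S t
  ... | inj₁ (w , _)             = image M w
  ... | inj₂ (u , v , e , i , _) = pathAt (Q u v e) (suc (toℕ i))

  vertexImage-cases : ∀ t →
      (∃ λ w → branch S w ≡ t × vertexImage t ≡ image M w)
    ⊎ (∃ λ u → ∃ λ v → Σ (Arc F u v) λ e → ∃ λ i →
         internal (P u v e) i ≡ t × vertexImage t ≡ pathAt (Q u v e) (suc (toℕ i)))
  vertexImage-cases t with covers-vertices S t
  ... | inj₁ (w , eq)             = inj₁ (w , eq , refl)
  ... | inj₂ (u , v , e , i , eq) = inj₂ (u , v , e , i , eq , refl)

  vertexImage-branch : ∀ w → vertexImage (branch S w) ≡ image M w
  vertexImage-branch w with vertexImage-cases (branch S w)
  ... | inj₁ (w' , eq , im) = trans im (cong (image M) (branch-inj S eq))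
  ... | inj₂ (u , v , e , i , eq , _) = contradiction eq (internal-not-branch S u v e i w)

  vertexImage-internal : ∀ u v e i → vertexImage (internal (P u v e) i) ≡ pathAt (Q u v e) (suc (toℕ i))
  vertexImage-internal u v e i with vertexImage-cases (internal (P u v e) i)
  ... | inj₁ (w , eq , _) = contradiction (sym eq) (internal-not-branch S u v e i w)
  ... | inj₂ (u' , v' , e' , i' , eq , im) with internal-disjoint S u' v' e' u v e i' i eq
  ...   | refl , refl with Bool-≡-irrelevant e e'
  ...     | refl = trans im (cong (λ t → pathAt (Q u v e) (suc t)) (suc-injective
              (pathAt-injective (P u v e) (s≤s (<⇒≤ (toℕ<n i'))) (s≤s (<⇒≤ (toℕ<n i)))
                (trans (sym (internal≡pathAt (P u v e) i')) (trans eq (internal≡pathAt (P u v e) i))))))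

  -- The last arc of P u v e absorbs the extra length of Q u v e.
  stretch : ∀ u v → Arc F u v → ℕ → ℕ
  stretch u v e r with r ≤? inner (P u v e)
  ... | yes _ = r
  ... | no  _ = suc (inner (Q u v e))

  stretch-≤ : ∀ {u v e r} → r ≤ inner (P u v e) → stretch u v e r ≡ r
  stretch-≤ {u} {v} {e} {r} r≤ with r ≤? inner (P u v e)
  ... | yes _  = refl
  ... | no  r≰ = contradiction r≤ r≰

  stretch-last : ∀ {u v e r} → ¬ r ≤ inner (P u v e) → stretch u v e r ≡ suc (inner (Q u v e))
  stretch-last {u} {v} {e} {r} r≰ with r ≤? inner (P u v e)
  ... | yes r≤ = contradiction r≤ r≰
  ... | no  _  = refl

  stretch-< : ∀ {u v e r} → r ≤ inner (P u v e) → stretch u v e r < stretch u v e (suc r)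
  stretch-< {u} {v} {e} {r} r≤ = increase (suc r ≤? inner (P u v e))
    where
    increase : Dec (suc r ≤ inner (P u v e)) → stretch u v e r < stretch u v e (suc r)
    increase (yes r<) = subst₂ _<_ (sym (stretch-≤ r≤)) (sym (stretch-≤ r<)) ≤-refl
    increase (no  r≮) =
      subst₂ _<_ (sym (stretch-≤ r≤)) (sym (stretch-last r≮)) (s≤s (≤-trans r≤ (long u v e)))

  stretch-bound : ∀ {u v e} r → stretch u v e (suc r) ≤ suc (inner (Q u v e))
  stretch-bound {u} {v} {e} r = bound (suc r ≤? inner (P u v e))
    where
    bound : Dec (suc r ≤ inner (P u v e)) → stretch u v e (suc r) ≤ suc (inner (Q u v e))
    bound (yes r<) = subst (_≤ _) (sym (stretch-≤ r<)) (≤-trans r< (m≤n⇒m≤1+n (long u v e)))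
    bound (no  r≮) = ≤-reflexive (stretch-last r≮)

  vertexImage-along : ∀ u v e {r} → r ≤ suc (inner (P u v e)) →
    vertexImage (pathAt (P u v e) r) ≡ pathAt (Q u v e) (stretch u v e r)
  vertexImage-along u v e {zero} _ = begin
    vertexImage (pathAt (P u v e) 0) ≡⟨ cong vertexImage (pathAt-start (P u v e)) ⟩
    vertexImage (branch S u)         ≡⟨ vertexImage-branch u ⟩
    image M u                        ≡⟨ sym (pathAt-start (Q u v e)) ⟩
    pathAt (Q u v e) 0               ≡⟨ cong (pathAt (Q u v e)) (sym (stretch-≤ {u} {v} {e} z≤n)) ⟩
    pathAt (Q u v e) (stretch u v e 0) ∎
    where open ≡-Reasoning
  vertexImage-along u v e {suc r} r≤ with suc r ≤? inner (P u v e)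
  ... | yes r< = begin
    vertexImage (pathAt (P u v e) (suc r))                  ≡⟨ cong vertexImage (pathAt-internal (P u v e) r<) ⟩
    vertexImage (internal (P u v e) (fromℕ< r<))            ≡⟨ vertexImage-internal u v e (fromℕ< r<) ⟩
    pathAt (Q u v e) (suc (toℕ (fromℕ< r<)))                ≡⟨ cong (λ t → pathAt (Q u v e) (suc t)) (toℕ-fromℕ< r<) ⟩
    pathAt (Q u v e) (suc r)                                ∎
    where open ≡-Reasoning
  ... | no r≮ = begin
    vertexImage (pathAt (P u v e) (suc r))                  ≡⟨ cong (vertexImage ∘ pathAt (P u v e)) (≤-antisym r≤ (≰⇒> r≮)) ⟩
    vertexImage (pathAt (P u v e) (suc (inner (P u v e))))  ≡⟨ cong vertexImage (pathAt-end (P u v e)) ⟩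
    vertexImage (branch S v)                                ≡⟨ vertexImage-branch v ⟩
    image M v                                               ≡⟨ sym (pathAt-end (Q u v e)) ⟩
    pathAt (Q u v e) (suc (inner (Q u v e)))                ∎
    where open ≡-Reasoning

  ArcOnPath : Vert T → Vert T → Set
  ArcOnPath t₁ t₂ = ∃ λ u → ∃ λ v → Σ (Arc F u v) λ e → ∃ λ i →
    seq (P u v e) (inject₁ i) ≡ t₁ × seq (P u v e) (suc i) ≡ t₂

  arcRoute : ∀ {t₁ t₂} → ArcOnPath t₁ t₂ → DiPath D (vertexImage t₁) (vertexImage t₂)
  arcRoute {t₁} {t₂} (u , v , e , i , eq₁ , eq₂) =
    castPath from to (subpath (Q u v e) (stretch-< r≤) (stretch-bound (toℕ i)))
    where
    r≤ : toℕ i ≤ inner (P u v e)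
    r≤ = s≤s⁻¹ (toℕ<n i)
    from : pathAt (Q u v e) (stretch u v e (toℕ i)) ≡ vertexImage t₁
    from = sym (trans (cong vertexImage (trans (sym eq₁) (trans (seq≡pathAt (P u v e) (inject₁ i))
                 (cong (pathAt (P u v e)) (toℕ-inject₁ i)))))
               (vertexImage-along u v e (m≤n⇒m≤1+n r≤)))
    to : pathAt (Q u v e) (stretch u v e (suc (toℕ i))) ≡ vertexImage t₂
    to = sym (trans (cong vertexImage (trans (sym eq₂) (seq≡pathAt (P u v e) (suc i))))
                    (vertexImage-along u v e (s≤s r≤)))

  arcRoute-internal : ∀ {t₁ t₂} u v e i
    (eq₁ : seq (P u v e) (inject₁ i) ≡ t₁) (eq₂ : seq (P u v e) (suc i) ≡ t₂) j →
    ∃ λ m → internal (arcRoute (u , v , e , i , eq₁ , eq₂)) j ≡ pathAt (Q u v e) m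
          × inner (P u v e) < m × m ≤ inner (Q u v e) × toℕ i ≡ inner (P u v e)
  arcRoute-internal u v e i eq₁ eq₂ j = onLastArc (suc (toℕ i) ≤? inner (P u v e))
    where
    r≤ : toℕ i ≤ inner (P u v e)
    r≤ = s≤s⁻¹ (toℕ<n i)
    m : ℕ
    m = stretch u v e (toℕ i) + suc (toℕ j)
    at : internal (arcRoute (u , v , e , i , eq₁ , eq₂)) j ≡ pathAt (Q u v e) m × m < stretch u v e (suc (toℕ i))
    at = internal-subpath (Q u v e) (stretch-< r≤) (stretch-bound (toℕ i)) j
    m≡ : m ≡ toℕ i + suc (toℕ j)
    m≡ = cong (_+ suc (toℕ j)) (stretch-≤ r≤)
    onLastArc : Dec (suc (toℕ i) ≤ inner (P u v e)) →
      ∃ λ m → internal (arcRoute (u , v , e , i , eq₁ , eq₂)) j ≡ pathAt (Q u v e) m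
            × inner (P u v e) < m × m ≤ inner (Q u v e) × toℕ i ≡ inner (P u v e)
    onLastArc (yes r<) = contradiction (proj₂ at)
      (≤⇒≯ (subst₂ _≤_ (sym (stretch-≤ r<)) (sym m≡)
        (≤-trans (s≤s (m≤m+n (toℕ i) (toℕ j))) (≤-reflexive (sym (+-suc (toℕ i) (toℕ j)))))))
    onLastArc (no r≮) =
      m , proj₁ at ,
      subst (inner (P u v e) <_) (sym m≡) (subst (_< toℕ i + suc (toℕ j)) i≡ (m<m+n (toℕ i) (s≤s z≤n))) ,
      s≤s⁻¹ (subst (m <_) (stretch-last r≮) (proj₂ at)) , i≡
      where
      i≡ : toℕ i ≡ inner (P u v e)
      i≡ = ≤-antisym r≤ (≮⇒≥ r≮)

  internal-position≤ : ∀ {u v e} (i : Fin (inner (P u v e))) → suc (toℕ i) ≤ inner (Q u v e)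
  internal-position≤ {u} {v} {e} i = ≤-trans (toℕ<n i) (long u v e)

  vertexImage-injective : ∀ {t t'} → vertexImage t ≡ vertexImage t' → t ≡ t'
  vertexImage-injective {t} {t'} eq with vertexImage-cases t | vertexImage-cases t'
  ... | inj₁ (w , bw , im) | inj₁ (w' , bw' , im') =
    trans (sym bw) (trans (cong (branch S) (image-injective M (trans (sym im) (trans eq im')))) bw')
  ... | inj₁ (w , _ , im) | inj₂ (u , v , e , i , _ , im') =
    contradiction (trans (sym im') (trans (sym eq) im)) (route-interior≢image M w (s≤s z≤n) (internal-position≤ i))
  ... | inj₂ (u , v , e , i , _ , im) | inj₁ (w , _ , im') =
    contradiction (trans (sym im) (trans eq im')) (route-interior≢image M w (s≤s z≤n) (internal-position≤ i))
  ... | inj₂ (u , v , e , i , it , im) | inj₂ (u' , v' , e' , i' , it' , im')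
    with route-interior-injective M (s≤s z≤n) (internal-position≤ i) (s≤s z≤n) (internal-position≤ i')
           (trans (sym im) (trans eq im'))
  ...   | refl , m≡ = trans (sym it) (trans (cong (internal (P u v e)) (toℕ-injective (suc-injective m≡))) it')

  arcRoute≢vertexImage : ∀ {t₁ t₂} (a : ArcOnPath t₁ t₂) j t → internal (arcRoute a) j ≢ vertexImage t
  arcRoute≢vertexImage (u , v , e , i , eq₁ , eq₂) j t eq
    with arcRoute-internal u v e i eq₁ eq₂ j | vertexImage-cases t
  ... | m , at , P< , m≤ , _ | inj₁ (w , _ , im) =
    route-interior≢image M w (≤-trans (s≤s z≤n) P<) m≤ (trans (sym at) (trans eq im))
  ... | m , at , P< , m≤ , _ | inj₂ (u' , v' , e' , i' , _ , im)
    with route-interior-injective M (≤-trans (s≤s z≤n) P<) m≤ (s≤s z≤n) (internal-position≤ i')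
           (trans (sym at) (trans eq im))
  ...   | refl , m≡ = <⇒≱ P< (subst (_≤ inner (P u v e)) (sym m≡) (toℕ<n i'))

  arcRoutes-disjoint : ∀ {t₁ t₂ t₁' t₂'} (a : ArcOnPath t₁ t₂) (a' : ArcOnPath t₁' t₂') j j' →
    internal (arcRoute a) j ≡ internal (arcRoute a') j' → t₁ ≡ t₁' × t₂ ≡ t₂'
  arcRoutes-disjoint (u , v , e , i , eq₁ , eq₂) (u' , v' , e' , i' , eq₁' , eq₂') j j' eq
    with arcRoute-internal u v e i eq₁ eq₂ j | arcRoute-internal u' v' e' i' eq₁' eq₂' j'
  ... | m , at , P< , m≤ , i-last | m' , at' , P<' , m'≤ , i'-last
    with route-interior-injective M (≤-trans (s≤s z≤n) P<) m≤ (≤-trans (s≤s z≤n) P<') m'≤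
           (trans (sym at) (trans eq at'))
  ...   | refl , _ with toℕ-injective (trans i-last (sym i'-last))
  ...     | refl = trans (sym eq₁) eq₁' , trans (sym eq₂) eq₂'

  refinedModel : SubdivisionModel T D
  refinedModel = record
    { image           = vertexImage
    ; image-injective = vertexImage-injective
    ; route           = λ t₁ t₂ a → arcRoute (covers-arcs S t₁ t₂ a)
    ; route≢image     = λ t₁ t₂ a → arcRoute≢vertexImage (covers-arcs S t₁ t₂ a)
    ; routes-disjoint = λ t₁ t₂ a t₁' t₂' a' →
                          arcRoutes-disjoint (covers-arcs S t₁ t₂ a) (covers-arcs S t₁' t₂' a')
    }

-- Subdivisions from models

record Enumeration {N : ℕ} (X : Fin N → Set) : Set where
  field
    count             : ℕ
    element           : Fin count → Fin N
    element-injective : Injective _≡_ _≡_ element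
    element∈          : ∀ i → X (element i)
    enumerates        : ∀ x → X x → ∃ λ i → element i ≡ x

enumerate : ∀ {N} {X : Fin N → Set} → Decidable X → Enumeration X
enumerate {zero} X? = record
  { count = 0 ; element = λ () ; element-injective = λ {} ; element∈ = λ () ; enumerates = λ () }
enumerate {suc N} {X} X? with enumerate (λ x → X? (suc x)) | X? zero
... | E | yes x₀ = record
  { count             = suc count
  ; element           = element′
  ; element-injective = injective′
  ; element∈          = λ { zero → x₀ ; (suc i) → element∈ i }
  ; enumerates        = λ { zero _ → zero , refl
                          ; (suc x) x∈ → let (i , eq) = enumerates x x∈ in suc i , cong suc eq }
  }
  where
  open Enumeration E
  element′ : Fin (suc count) → Fin (suc N)
  element′ zero    = zero
  element′ (suc i) = suc (element i)
  injective′ : Injective _≡_ _≡_ element′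
  injective′ {zero}  {zero}  _  = refl
  injective′ {suc i} {suc j} eq = cong suc (element-injective (suc-injectiveᶠ eq))
... | E | no ¬x₀ = record
  { count             = count
  ; element           = λ i → suc (element i)
  ; element-injective = λ eq → element-injective (suc-injectiveᶠ eq)
  ; element∈          = element∈
  ; enumerates        = λ { zero x₀ → contradiction x₀ ¬x₀
                          ; (suc x) x∈ → let (i , eq) = enumerates x x∈ in i , cong suc eq }
  }
  where open Enumeration E

does-true : ∀ {A : Set} (a? : Dec A) → does a? ≡ true → A
does-true (yes a) _ = a

∃-arc? : ∀ F u v {R : Arc F u v → Set} → (∀ e → Dec (R e)) → Dec (Σ (Arc F u v) R)
∃-arc? F u v {R} R? with arc? F u v
... | no ¬e = no λ (e , _) → ¬e e
... | yes e with R? e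
...   | yes r = yes (e , r)
...   | no ¬r = no λ (e' , r) → ¬r (subst R (Bool-≡-irrelevant e' e) r)

module _ {F D : Digraph} (M : SubdivisionModel F D) where

  OnModel : Vert D → Set
  OnModel x = (∃ λ w → image M w ≡ x)
            ⊎ (∃ λ u → ∃ λ v → Σ (Arc F u v) λ e → ∃ λ i → internal (route M u v e) i ≡ x)

  onModel? : Decidable OnModel
  onModel? x = any? (λ w → image M w ≟ᶠ x)
         ⊎-dec any? λ u → any? λ v → ∃-arc? F u v λ e → any? λ i → internal (route M u v e) i ≟ᶠ x

  RouteArc : Vert D → Vert D → Set
  RouteArc x y = ∃ λ u → ∃ λ v → Σ (Arc F u v) λ e → ∃ λ i →
    seq (route M u v e) (inject₁ i) ≡ x × seq (route M u v e) (suc i) ≡ y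

  routeArc? : ∀ x y → Dec (RouteArc x y)
  routeArc? x y = any? λ u → any? λ v → ∃-arc? F u v λ e → any? λ i →
    (seq (route M u v e) (inject₁ i) ≟ᶠ x) ×-dec (seq (route M u v e) (suc i) ≟ᶠ y)

  routeArc-irreflexive : ∀ x → ¬ RouteArc x x
  routeArc-irreflexive x (u , v , e , i , eq₁ , eq₂) = <⇒≢ (n<1+n (toℕ i))
    (trans (sym (toℕ-inject₁ i)) (cong toℕ (pinj (route M u v e) (trans eq₁ (sym eq₂)))))

  seq-onModel : ∀ u v e t → OnModel (seq (route M u v e) t)
  seq-onModel u v e zero    = inj₁ (u , sym (start (route M u v e)))
  seq-onModel u v e (suc t) with view t
  ... | ‵fromℕ      = inj₁ (v , sym (end (route M u v e)))
  ... | ‵inject₁ i  = inj₂ (u , v , e , i , refl)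

  open Enumeration (enumerate onModel?)

  private
    position : ∀ {x} → OnModel x → Fin count
    position {x} x∈ = proj₁ (enumerates x x∈)

    element-position : ∀ {x} (x∈ : OnModel x) → element (position x∈) ≡ x
    element-position {x} x∈ = proj₂ (enumerates x x∈)

    position-cong : ∀ {x y} (x∈ : OnModel x) (y∈ : OnModel y) → x ≡ y → position x∈ ≡ position y∈
    position-cong x∈ y∈ x≡y =
      element-injective (trans (element-position x∈) (trans x≡y (sym (element-position y∈))))

    position-injective : ∀ {x y} (x∈ : OnModel x) (y∈ : OnModel y) → position x∈ ≡ position y∈ → x ≡ y
    position-injective x∈ y∈ eq = trans (sym (element-position x∈)) (trans (cong element eq) (element-position y∈))

    position-element : ∀ {x} (x∈ : OnModel x) {i} → x ≡ element i → position x∈ ≡ i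
    position-element x∈ x≡ = element-injective (trans (element-position x∈) x≡)

  modelDigraph : Digraph
  modelDigraph = record
    { size     = count
    ; arc      = λ i j → does (routeArc? (element i) (element j))
    ; loopless = λ i → dec-false (routeArc? _ _) (routeArc-irreflexive (element i))
    }

  private
    H : Digraph
    H = modelDigraph

    branchH : Vert F → Vert H
    branchH w = position (inj₁ (w , refl))

    pathH : ∀ u v e → DiPath H (branchH u) (branchH v)
    pathH u v e = record
      { inner = inner Q
      ; seq   = λ t → position (seq-onModel u v e t)
      ; start = position-cong _ _ (start Q)
      ; end   = position-cong _ _ (end Q)
      ; pinj  = λ eq → pinj Q (position-injective _ _ eq)
      ; pstep = λ i → dec-true (routeArc? _ _) (u , v , e , i , sym (element-position _) , sym (element-position _))
      }
      where
      Q : DiPath D (image M u) (image M v)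
      Q = route M u v e

    arcH : ∀ {x y} → Arc H x y → RouteArc (element x) (element y)
    arcH {x} {y} = does-true (routeArc? (element x) (element y))

  modelDigraph-isSubdivision : IsSubdivision F modelDigraph
  modelDigraph-isSubdivision = record
    { branch              = branchH
    ; branch-inj          = λ eq → image-injective M (position-injective _ _ eq)
    ; path                = pathH
    ; internal-not-branch = λ u v e i w eq → route≢image M u v e i w (position-injective _ _ eq)
    ; internal-disjoint   = λ u v e u' v' e' i i' eq → routes-disjoint M u v e u' v' e' i i' (position-injective _ _ eq)
    ; covers-vertices     = λ x → cover x (element∈ x)
    ; covers-arcs         = λ x y a → let (u , v , e , i , eq₁ , eq₂) = arcH a in
                              u , v , e , i , position-element _ eq₁ , position-element _ eq₂
    }
    where
    cover : ∀ x → OnModel (element x) → (∃ λ w → branchH w ≡ x)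
      ⊎ (∃ λ u → ∃ λ v → Σ (Arc F u v) λ e → ∃ λ i → internal (pathH u v e) i ≡ x)
    cover x (inj₁ (w , eq))             = inj₁ (w , position-element _ eq)
    cover x (inj₂ (u , v , e , i , eq)) = inj₂ (u , v , e , i , position-element _ eq)

  modelDigraph-embeds : Embeds modelDigraph D
  modelDigraph-embeds = element , element-injective , λ x y a →
    let (u , v , e , i , eq₁ , eq₂) = arcH a in subst₂ (Arc D) eq₁ eq₂ (pstep (route M u v e) i)

  model⇒contains : ContainsSubdivision D F
  model⇒contains = modelDigraph , modelDigraph-isSubdivision , modelDigraph-embeds

-- The lower bound and the theorem

completeDigraph : ℕ → Digraph
completeDigraph c = record
  { size = c ; arc = λ u v → not (does (u ≟ᶠ v)) ; loopless = λ u → cong not (dec-true (u ≟ᶠ u) refl) }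

completeDigraph-arc : ∀ {c} {u v : Fin c} → u ≢ v → Arc (completeDigraph c) u v
completeDigraph-arc {u = u} {v} u≢v = cong not (dec-false (u ≟ᶠ v) u≢v)

completeDigraph-dichromatic : ∀ c → DichromaticAtLeast (completeDigraph c) c
completeDigraph-dichromatic c j j<c (f , acyclic) =
  let (a , b , a<b , fa≡fb) = pigeonhole j<c f
      a≢b = <⇒≢ᶠ a<b
      vert₂ : Fin 2 → Fin c
      vert₂ = λ { zero → a ; (suc zero) → b }
      digon : DiCycle (completeDigraph c)
      digon = record
        { len   = 1
        ; vert  = vert₂
        ; inj   = λ { {zero} {zero} _ → refl ; {zero} {suc zero} a≡b → contradiction a≡b a≢b
                    ; {suc zero} {zero} b≡a → contradiction (sym b≡a) a≢b ; {suc zero} {suc zero} _ → refl }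
        ; step  = λ { zero → completeDigraph-arc a≢b }
        ; close = completeDigraph-arc (λ b≡a → a≢b (sym b≡a))
        }
  in acyclic digon (f a) λ { zero → refl ; (suc zero) → sym fa≡fb }

digirth≥2 : ∀ D → DigirthAtLeast D 2
digirth≥2 D C = s≤s (len-positive C)

mader-≥-size : ∀ {F c} → c < size F → ¬ MaderProp 2 F c
mader-≥-size {F} {c} c<F mader =
  let (H , S , ι , ι-injective , _) = mader (completeDigraph c) (completeDigraph-dichromatic c) (digirth≥2 _)
  in <⇒≱ c<F (injective⇒≤ (λ eq → branch-inj S (ι-injective eq)))

module _ {G : Graph} (tree : IsTree G) where

  mader-subdividedBidirectedTree : ∀ {ℓ T} (S : IsSubdivision (bidirect G) T) →
    (∀ u v e → inner (path S u v e) ≤ ℓ) → MaderProp (2 * suc ℓ) T (gsize G)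
  mader-subdividedBidirectedTree {ℓ} S short D χ≥n girth =
    model⇒contains (Refinement.refinedModel S model (λ u v e → ≤-trans (short u v e) (model-long u v e)))
    where open BidirectedTreeModel D G tree ℓ χ≥n girth

  mader-bidirectedTree : IsMader 2 (bidirect G) (gsize G)
  mader-bidirectedTree =
    (λ D χ≥n girth → model⇒contains (BidirectedTreeModel.model D G tree 0 χ≥n girth)) ,
    λ _ → mader-≥-size

theorem6 : (k : ℕ) → 1 ≤ k → (G : Graph) → IsTree G →
           (Tstar : Digraph) → (S : IsSubdivision (bidirect G) Tstar) →
           (∀ u v (e : Arc (bidirect G) u v) → inner (path S u v e) ≤ k ∸ 1) →
           MaderProp (2 * k) Tstar (gsize G) × IsMader 2 (bidirect G) (gsize G)
theorem6 (suc ℓ) _ G tree Tstar S short = mader-subdividedBidirectedTree tree S short , mader-bidirectedTree tree
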